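{- Let $G$ be a graph of order $n\ge3$. Then $\operatorname{th_{dim}}(G)=n-1$ if and only if $G$ or its complement $\overline{G}$ is one of the following: (i) the disjoint union of a star and any number of isolated vertices; (ii) $G_p+G_{n-p}$ for some integer $p\in[0,n]$, where each $G_q$ denotes a graph isomorphic to either $K_q$ or $\overline{K_q}$ (chosen independently for the two parts) and $+$ denotes disjoint union; (iii) $P_4$.
   Context: All graphs are finite and simple; $\overline{H}$ is the complement of $H$; $K_q$ is the complete graph and $P_4$ the path on $4$ vertices. $\operatorname{dist}(u,v)$ is the shortest-path distance ($\infty$ across components). For a nonnegative integer $r$, $\operatorname{dist}_r(x,v)=\min(\operatorname{dist}(x,v),r+1)$. A set $S\subseteq V(G)$ is a distance-$r$ resolving set if for all distinct $x,y\in V(G)$ there is $v\in S$ with $\operatorname{dist}_r(v,x)\ne\operatorname{dist}_r(v,y)$. $\dim_r(G)$ is the minimum size of such a set and $\operatorname{th_{dim}}(G)=\min_{r\ge0}(r+\dim_r(G))$ over nonnegative integers $r$. -}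

module Defs where

open import Data.Nat using (ℕ; zero; suc; _+_; _∸_; _≤_; _<ᵇ_)
open import Data.Bool using (Bool; true; false; _∧_; _∨_; not; if_then_else_)
open import Data.Bool.Properties using (∨-comm)
open import Data.Fin using (Fin; toℕ)
import Data.Fin as F
open import Data.Fin.Subset using (Subset; _∈_; ∣_∣)
open import Data.Product using (Σ; ∃; ∃-syntax; _×_; _,_)
open import Data.Sum using (_⊎_)
open import Relation.Nullary using (¬_)
open import Relation.Binary.PropositionalEquality using (_≡_; _≢_; refl; cong)
open import Function.Bundles using (_↔_; Inverse)

eqb : ℕ → ℕ → Bool
eqb zero zero = true
eqb zero (suc _) = false
eqb (suc _) zero = false
eqb (suc m) (suc n) = eqb m n

eqb-refl : ∀ m → eqb m m ≡ true
eqb-refl zero = refl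
eqb-refl (suc m) = eqb-refl m

eqb-sym : ∀ m n → eqb m n ≡ eqb n m
eqb-sym zero zero = refl
eqb-sym zero (suc n) = refl
eqb-sym (suc m) zero = refl
eqb-sym (suc m) (suc n) = eqb-sym m n

record Graph (n : ℕ) : Set where
  field
    adj    : Fin n → Fin n → Bool
    irrefl : ∀ i → adj i i ≡ false
    sym    : ∀ i j → adj i j ≡ adj j i
open Graph public

mkGraph : ∀ {n} → (Fin n → Fin n → Bool) → Graph n
mkGraph f = record
  { adj    = λ i j → not (eqb (toℕ i) (toℕ j)) ∧ (f i j ∨ f j i)
  ; irrefl = λ i → irr i
  ; sym    = λ i j → sy i j
  }
  where
  irr : ∀ i → not (eqb (toℕ i) (toℕ i)) ∧ (f i i ∨ f i i) ≡ false
  irr i rewrite eqb-refl (toℕ i) = refl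
  sy : ∀ i j → not (eqb (toℕ i) (toℕ j)) ∧ (f i j ∨ f j i)
             ≡ not (eqb (toℕ j) (toℕ i)) ∧ (f j i ∨ f i j)
  sy i j rewrite eqb-sym (toℕ i) (toℕ j) | ∨-comm (f i j) (f j i) = refl

complement : ∀ {n} → Graph n → Graph n
complement G = mkGraph (λ i j → not (adj G i j))

_≅_ : ∀ {n} → Graph n → Graph n → Set
_≅_ {n} G H = Σ (Fin n ↔ Fin n) λ f →
  ∀ i j → adj G i j ≡ adj H (Inverse.to f i) (Inverse.to f j)

anyFin : ∀ {n} → (Fin n → Bool) → Bool
anyFin {zero} f = false
anyFin {suc n} f = f F.zero ∨ anyFin (λ i → f (F.suc i))

-- reach G k x y = true iff there is a walk of length ≤ k from x to y,
-- i.e. iff dist(x,y) ≤ k.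
reach : ∀ {n} → Graph n → ℕ → Fin n → Fin n → Bool
reach G zero x y = eqb (toℕ x) (toℕ y)
reach G (suc k) x y = reach G k x y ∨ anyFin (λ z → reach G k x z ∧ adj G z y)

-- distR G r x v = dist_r(x,v) = min(dist(x,v), r+1)
distR : ∀ {n} → Graph n → ℕ → Fin n → Fin n → ℕ
distR G zero x v = if reach G zero x v then 0 else 1
distR G (suc r) x v =
  if reach G r x v then distR G r x v
  else (if reach G (suc r) x v then suc r else suc (suc r))

Resolving : ∀ {n} → Graph n → ℕ → Subset n → Set
Resolving {n} G r S = ∀ (x y : Fin n) → x ≢ y →
  ∃[ v ] (v ∈ S × distR G r v x ≢ distR G r v y)

IsDimR : ∀ {n} → Graph n → ℕ → ℕ → Set
IsDimR G r k = (∃[ S ] (Resolving G r S × ∣ S ∣ ≡ k))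
             × (∀ S → Resolving G r S → k ≤ ∣ S ∣)

IsThDim : ∀ {n} → Graph n → ℕ → Set
IsThDim G t = (∃[ r ] ∃[ k ] (IsDimR G r k × r + k ≡ t))
            × (∀ r k → IsDimR G r k → t ≤ r + k)

-- Star K_{1,m} (centre 0, leaves 1..m) plus n-1-m isolated vertices.
starPlusIsolated : (n m : ℕ) → Graph n
starPlusIsolated n m = mkGraph (λ i j →
  eqb (toℕ i) 0 ∧ (0 <ᵇ toℕ j) ∧ (toℕ j <ᵇ suc m))

-- G_p + G_{n-p}: vertices 0..p-1 form one part, p..n-1 the other;
-- part one is complete iff a = true (else edgeless), part two complete iff b = true.
twoParts : (n p : ℕ) → Bool → Bool → Graph n
twoParts n p a b = mkGraph (λ i j →
  ((toℕ i <ᵇ p) ∧ (toℕ j <ᵇ p) ∧ a) ∨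
  (not (toℕ i <ᵇ p) ∧ not (toℕ j <ᵇ p) ∧ b))

pathGraph : (n : ℕ) → Graph n
pathGraph n = mkGraph (λ i j → eqb (suc (toℕ i)) (toℕ j))

InFamily : ∀ {n} → Graph n → Set
InFamily {n} G =
    (∃[ m ] (1 ≤ m × suc m ≤ n × G ≅ starPlusIsolated n m))
  ⊎ (∃[ p ] ∃[ a ] ∃[ b ] (p ≤ n × G ≅ twoParts n p a b))
  ⊎ (n ≡ 4 × G ≅ pathGraph n)

-- Twins, i.e. vertices with the same neighbours apart from each other, are at the same
-- distance from every third vertex, so no other vertex separates them at any radius.
-- All vertices but one resolve G at radius 0, hence th_dim(G) = n - 1 says exactly
-- that every distance-r resolving set has at least n - 1 - r vertices. At radius 1
-- distances only see adjacency, and there the bound says that among any three vertices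
-- two are twins apart from the third ("twinned triples"). Conversely, twinned triples
-- give the bound at radius 1, and for r ≥ 2 it suffices that any four vertices contain
-- a twin pair; this holds in every graph of the family except P₄, where n = 4 makes it
-- unnecessary. Finally, twinned triples force the family: if the twins of one vertex
-- and the remaining vertices form two classes of mutual twins, G or its complement is
-- G_p + G_{n-p}; otherwise there are three pairwise non-twin vertices, and the twin
-- relations between them and the other vertices leave only a star with isolated
-- vertices or P₄, again up to complementation.

module Submission where

open import Defs renaming (sym to adj-sym)
open import Data.Nat using (ℕ; zero; suc; _+_; _∸_; _≤_; _<_; _<ᵇ_; z≤n; s≤s; _≤?_)
import Data.Nat.Properties as ℕ
open import Data.Nat.Induction using (<-wellFounded)
open import Induction.WellFounded using (Acc; acc)
open import Data.Bool using (Bool; true; false; _∧_; _∨_; not; if_then_else_)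
import Data.Bool.Properties as Bool
open import Data.Fin using (Fin; zero; suc; toℕ; fromℕ<; punchIn; #_)
open import Data.Fin.Properties
  using (_≟_; toℕ-injective; suc-injective; toℕ<n; toℕ-fromℕ<; all?; any?; ¬Fin0; <⇒≢; pigeonhole; injective⇒≤)
open import Data.Fin.Subset using (Subset; _∈_; _∉_; ∣_∣; ∁; ⁅_⁆; ⊤; _-_)
open import Data.Fin.Subset.Properties
  using ( _∈?_; anySubset?; ∣∁p∣≡n∸∣p∣; ∣⁅x⁆∣≡1; ∣p∣≤n; ∣⊤∣≡n; ∈⊤; x∈p⇒∣p-x∣<∣p∣; x∈p∧x≢y⇒x∈p-y
        ; x∈∁p⇒x∉p; x∉∁p⇒x∈p; x∉p⇒x∈∁p; x∈⁅y⁆⇒x≡y; x≢y⇒x∉⁅y⁆ )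
open import Data.Fin.Permutation
  using (Permutation; _⟨$⟩ʳ_; permutation; insert; insert-punchIn; transpose; _∘ₚ_)
import Data.Fin.Permutation as Permutation
import Data.Fin.Permutation.Components as PC
open import Data.Vec using (_∷_)
open import Data.Vec.Base using (here; there)
open import Data.Product using (Σ; ∃; ∃₂; _×_; _,_; proj₁; proj₂)
open import Data.Sum using (_⊎_; inj₁; inj₂)
import Data.Sum as Sum
open import Data.Empty using (⊥; ⊥-elim)
open import Function using (_∘_; case_of_)
open import Function.Bundles using (_⇔_; mk⇔; Injection)
open import Function.Definitions using (Injective)
open import Function.Nary.NonDependent using (congₙ)
open import Function.Properties.Inverse using (↔⇒↣)
open import Relation.Nullary using (¬_; Dec; yes; no; does)
open import Relation.Nullary.Decidable
  using (¬?; _×-dec_; _⊎-dec_; _→-dec_; dec-true; dec-false; decidable-stable; from-yes; map′)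
open import Relation.Binary.PropositionalEquality

bool-clash : ∀ {p q : Bool} → p ≡ true → q ≡ false → p ≢ q
bool-clash refl refl ()

bool-pigeonhole : ∀ (a b c : Bool) → a ≡ b ⊎ a ≡ c ⊎ b ≡ c
bool-pigeonhole true  true  _     = inj₁ refl
bool-pigeonhole false false _     = inj₁ refl
bool-pigeonhole true  false true  = inj₂ (inj₁ refl)
bool-pigeonhole false true  false = inj₂ (inj₁ refl)
bool-pigeonhole true  false false = inj₂ (inj₂ refl)
bool-pigeonhole false true  true  = inj₂ (inj₂ refl)

eqb-≢ : ∀ {m n} → m ≢ n → eqb m n ≡ false
eqb-≢ {zero}  {zero}  m≢n = ⊥-elim (m≢n refl)
eqb-≢ {zero}  {suc n} _   = refl
eqb-≢ {suc m} {zero}  _   = refl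
eqb-≢ {suc m} {suc n} m≢n = eqb-≢ (m≢n ∘ cong suc)

eqb-toℕ-≢ : ∀ {n} {i j : Fin n} → i ≢ j → eqb (toℕ i) (toℕ j) ≡ false
eqb-toℕ-≢ i≢j = eqb-≢ (i≢j ∘ toℕ-injective)

adj-complement : ∀ {n} (G : Graph n) {i j} → i ≢ j → adj (complement G) i j ≡ not (adj G i j)
adj-complement G {i} {j} i≢j rewrite eqb-toℕ-≢ i≢j | adj-sym G j i = Bool.∨-idem _

adj⇒≢ : ∀ {n} (G : Graph n) {i j} → adj G i j ≡ true → i ≢ j
adj⇒≢ G ij refl = bool-clash ij (irrefl G _) refl

permutation-injective : ∀ {n} (σ : Permutation n n) → Injective _≡_ _≡_ (σ ⟨$⟩ʳ_)
permutation-injective σ = Injection.injective (↔⇒↣ σ)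

anyFin-witness : ∀ {n} (f : Fin n → Bool) → anyFin f ≡ true → ∃ λ i → f i ≡ true
anyFin-witness {zero}  f ()
anyFin-witness {suc n} f any-f with f zero in f0
... | true  = zero , f0
... | false = let i , fi = anyFin-witness (f ∘ suc) any-f in suc i , fi

anyFin-intro : ∀ {n} (f : Fin n → Bool) i → f i ≡ true → anyFin f ≡ true
anyFin-intro f zero    fi rewrite fi = refl
anyFin-intro f (suc i) fi rewrite anyFin-intro (λ j → f (suc j)) i fi = Bool.∨-zeroʳ (f zero)

anyFin-false : ∀ n → anyFin {n} (λ _ → false) ≡ false
anyFin-false zero    = refl
anyFin-false (suc n) = anyFin-false n

anyFin-eqb : ∀ {n} (v : Fin n) (g : Fin n → Bool) →
  anyFin (λ w → eqb (toℕ v) (toℕ w) ∧ g w) ≡ g v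
anyFin-eqb {suc n} zero    g = trans (cong (g zero ∨_) (anyFin-false n)) (Bool.∨-identityʳ (g zero))
anyFin-eqb {suc n} (suc v) g = anyFin-eqb v (g ∘ suc)

reach-refl : ∀ {n} (G : Graph n) k v → reach G k v v ≡ true
reach-refl G zero    v = eqb-refl (toℕ v)
reach-refl G (suc k) v rewrite reach-refl G k v = refl

distR≢0 : ∀ {n} (G : Graph n) r {p q} → p ≢ q → distR G r p q ≢ 0
distR≢0 G zero    p≢q rewrite eqb-toℕ-≢ p≢q = λ ()
distR≢0 G (suc r) {p} {q} p≢q with reach G r p q | reach G (suc r) p q
... | true  | _     = distR≢0 G r p≢q
... | false | true  = λ ()
... | false | false = λ ()

distR-separates-self : ∀ {n} (G : Graph n) r {p q} → p ≢ q → distR G r p p ≢ distR G r p q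
distR-separates-self G r {p} p≢q p≡q = distR≢0 G r p≢q (trans (sym p≡q) (distR-refl r))
  where
  distR-refl : ∀ r → distR G r p p ≡ 0
  distR-refl zero    rewrite eqb-refl (toℕ p) = refl
  distR-refl (suc r) rewrite reach-refl G r p = distR-refl r

distR₀ : ∀ {n} (G : Graph n) {v x} → v ≢ x → distR G 0 v x ≡ 1
distR₀ G v≢x rewrite eqb-toℕ-≢ v≢x = refl

distR₁ : ∀ {n} (G : Graph n) {v x} → v ≢ x → distR G 1 v x ≡ (if adj G v x then 1 else 2)
distR₁ G {v} {x} v≢x rewrite eqb-toℕ-≢ v≢x | anyFin-eqb v (λ w → adj G w x) = refl

distR₁-≡ : ∀ {n} (G : Graph n) {v a b} → v ≢ a → v ≢ b →
  adj G v a ≡ adj G v b → distR G 1 v a ≡ distR G 1 v b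
distR₁-≡ G v≢a v≢b e rewrite distR₁ G v≢a | distR₁ G v≢b | e = refl

distR₁-≢ : ∀ {n} (G : Graph n) {v a b} → v ≢ a → v ≢ b →
  adj G v a ≢ adj G v b → distR G 1 v a ≢ distR G 1 v b
distR₁-≢ G v≢a v≢b d rewrite distR₁ G v≢a | distR₁ G v≢b = d ∘ if-1-2-injective
  where
  if-1-2-injective : ∀ {s t} → (if s then 1 else 2) ≡ (if t then 1 else 2) → s ≡ t
  if-1-2-injective {true}  {true}  _ = refl
  if-1-2-injective {false} {false} _ = refl

-- Twins

Twins : ∀ {n} → Graph n → Fin n → Fin n → Set
Twins G a b = ∀ u → u ≢ a → u ≢ b → adj G u a ≡ adj G u b

TwinsExcept : ∀ {n} → Graph n → Fin n → Fin n → Fin n → Set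
TwinsExcept G c a b = ∀ u → u ≢ a → u ≢ b → u ≢ c → adj G u a ≡ adj G u b

TwinnedTriples : ∀ {n} → Graph n → Set
TwinnedTriples G = ∀ x y z → x ≢ y → x ≢ z → y ≢ z →
  TwinsExcept G z x y ⊎ TwinsExcept G y x z ⊎ TwinsExcept G x y z

TwinnedQuadruples : ∀ {n} → Graph n → Set
TwinnedQuadruples {n} G = (f : Fin 4 → Fin n) → Injective _≡_ _≡_ f →
  ∃₂ λ i j → i ≢ j × Twins G (f i) (f j)

module _ {n} (G : Graph n) where

  twins-refl : ∀ {a} → Twins G a a
  twins-refl _ _ _ = refl

  twins-sym : ∀ {a b} → Twins G a b → Twins G b a
  twins-sym t u u≢b u≢a = sym (t u u≢a u≢b)

  twinsExcept-sym : ∀ {a b c} → TwinsExcept G c a b → TwinsExcept G c b a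
  twinsExcept-sym t u u≢b u≢a u≢c = sym (t u u≢a u≢b u≢c)

  twins⇒twinsExcept : ∀ {a b c} → Twins G a b → TwinsExcept G c a b
  twins⇒twinsExcept t u u≢a u≢b _ = t u u≢a u≢b

  twinsExcept-self⇒twins : ∀ {a b} → TwinsExcept G a a b → Twins G a b
  twinsExcept-self⇒twins t u u≢a u≢b = t u u≢a u≢b u≢a

  twinsExcept⇒twins : ∀ {a b c} → TwinsExcept G c a b → adj G c a ≡ adj G c b → Twins G a b
  twinsExcept⇒twins {c = c} t ca≡cb u u≢a u≢b with u ≟ c
  ... | yes refl = ca≡cb
  ... | no u≢c   = t u u≢a u≢b u≢c

  twins-trans : ∀ {o i j} → Twins G o i → Twins G o j → i ≢ j → Twins G i j
  twins-trans {o} {i} {j} o≈i o≈j i≢j with i ≟ o | j ≟ o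
  ... | yes refl | _        = o≈j
  ... | no _     | yes refl = twins-sym o≈i
  ... | no i≢o   | no j≢o   = agree
    where
    agree : Twins G i j
    agree u u≢i u≢j with u ≟ o
    ... | no u≢o   = trans (sym (o≈i u u≢o u≢i)) (o≈j u u≢o u≢j)
    ... | yes refl = begin
      adj G o i ≡⟨ adj-sym G o i ⟩
      adj G i o ≡⟨ o≈j i i≢o i≢j ⟩
      adj G i j ≡⟨ adj-sym G i j ⟩
      adj G j i ≡⟨ sym (o≈i j j≢o (i≢j ∘ sym)) ⟩
      adj G j o ≡⟨ adj-sym G j o ⟩
      adj G o j ∎
      where open ≡-Reasoning

separator-or-twinsExcept : ∀ {n} (G : Graph n) c a b →
  (∃ λ u → u ≢ a × u ≢ b × u ≢ c × adj G u a ≢ adj G u b) ⊎ TwinsExcept G c a b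
separator-or-twinsExcept G c a b
  with any? (λ u → ¬? (u ≟ a) ×-dec ¬? (u ≟ b) ×-dec ¬? (u ≟ c) ×-dec ¬? (adj G u a Bool.≟ adj G u b))
... | yes separator = inj₁ separator
... | no none = inj₂ λ u u≢a u≢b u≢c →
  decidable-stable (adj G u a Bool.≟ adj G u b) (λ d → none (u , u≢a , u≢b , u≢c , d))

twinsExcept? : ∀ {n} (G : Graph n) c a b → Dec (TwinsExcept G c a b)
twinsExcept? G c a b with separator-or-twinsExcept G c a b
... | inj₁ (u , u≢a , u≢b , u≢c , d) = no λ t → d (t u u≢a u≢b u≢c)
... | inj₂ t                         = yes t

twins? : ∀ {n} (G : Graph n) a b → Dec (Twins G a b)
twins? G a b = map′ (twinsExcept-self⇒twins G) (twins⇒twinsExcept G) (twinsExcept? G a a b)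

¬twins⇒separator : ∀ {n} (G : Graph n) {a b} → ¬ Twins G a b →
  ∃ λ u → u ≢ a × u ≢ b × adj G u a ≢ adj G u b
¬twins⇒separator G {a} {b} a≁b with separator-or-twinsExcept G a a b
... | inj₁ (u , u≢a , u≢b , _ , d) = u , u≢a , u≢b , d
... | inj₂ t                       = ⊥-elim (a≁b (twinsExcept-self⇒twins G t))

twinnedTriples? : ∀ {n} (G : Graph n) → Dec (TwinnedTriples G)
twinnedTriples? G = all? λ x → all? λ y → all? λ z →
  ¬? (x ≟ y) →-dec ¬? (x ≟ z) →-dec ¬? (y ≟ z) →-dec
  (twinsExcept? G z x y ⊎-dec twinsExcept? G y x z ⊎-dec twinsExcept? G x y z)

reach-twins : ∀ {n} (G : Graph n) {a b v} → Twins G a b → v ≢ a → v ≢ b →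
  ∀ k → reach G k v a ≡ reach G k v b
reach-twins G _ v≢a v≢b zero rewrite eqb-toℕ-≢ v≢a | eqb-toℕ-≢ v≢b = refl
reach-twins G {a} {b} {v} a≈b v≢a v≢b (suc k) =
  Bool.⇔→≡ (mk⇔ (extend a≈b (reach-twins G a≈b v≢a v≢b k))
                (extend (twins-sym G a≈b) (sym (reach-twins G a≈b v≢a v≢b k))))
  where
  extend : ∀ {a b} → Twins G a b → reach G k v a ≡ reach G k v b →
           reach G (suc k) v a ≡ true → reach G (suc k) v b ≡ true
  extend {a} {b} a≈b same reach-a with reach G k v b in vb
  ... | true  = refl
  ... | false with anyFin-witness (λ w → reach G k v w ∧ adj G w a)
                    (subst (λ s → s ∨ anyFin (λ w → reach G k v w ∧ adj G w a) ≡ true) same reach-a)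
  ...   | w , vw∧wa = anyFin-intro _ w (trans (cong (reach G k v w ∧_) (sym (a≈b w w≢a w≢b))) vw∧wa)
    where
    w≢a : w ≢ a
    w≢a = adj⇒≢ G (Bool.∧-conicalʳ _ _ vw∧wa)
    w≢b : w ≢ b
    w≢b w≡b = bool-clash (Bool.∧-conicalˡ _ _ vw∧wa) vb (cong (reach G k v) w≡b)

distR-twins : ∀ {n} (G : Graph n) {a b v} → Twins G a b → v ≢ a → v ≢ b →
  ∀ r → distR G r v a ≡ distR G r v b
distR-twins G a≈b v≢a v≢b zero = cong (λ s → if s then 0 else 1) (reach-twins G a≈b v≢a v≢b 0)
distR-twins G a≈b v≢a v≢b (suc r) =
  congₙ 3 (λ (s : Bool) (d : ℕ) (t : Bool) → if s then d else (if t then suc r else suc (suc r)))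
    (reach-twins G a≈b v≢a v≢b r) (distR-twins G a≈b v≢a v≢b r) (reach-twins G a≈b v≢a v≢b (suc r))

-- Resolving sets

resolving? : ∀ {n} (G : Graph n) r S → Dec (Resolving G r S)
resolving? G r S = all? λ x → all? λ y → ¬? (x ≟ y) →-dec
  any? (λ v → (v ∈? S) ×-dec ¬? (distR G r v x ℕ.≟ distR G r v y))

least-witness : ∀ {P : ℕ → Set} → (∀ m → Dec (P m)) → ∀ {m} → P m →
  ∃ λ k → P k × ∀ {j} → P j → k ≤ j
least-witness {P} P? {m} Pm = go (<-wellFounded m) Pm
  where
  go : ∀ {m} → Acc _<_ m → P m → ∃ λ k → P k × ∀ {j} → P j → k ≤ j
  go {m} (acc smaller) Pm with any? (λ (j : Fin m) → P? (toℕ j))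
  ... | yes (j , Pj) = go (smaller (toℕ<n j)) Pj
  ... | no none      = m , Pm , λ {j} Pj → ℕ.≮⇒≥ λ j<m →
    none (fromℕ< j<m , subst P (sym (toℕ-fromℕ< j<m)) Pj)

dimR-exists : ∀ {n} (G : Graph n) r {S} → Resolving G r S →
  ∃ λ k → IsDimR G r k × k ≤ ∣ S ∣
dimR-exists G r {S} R =
  let k , smallest , minimal = least-witness sized? (S , R , refl)
  in k , (smallest , λ S′ R′ → minimal (S′ , R′ , refl)) , minimal (S , R , refl)
  where
  sized? : ∀ m → Dec (∃ λ S → Resolving G r S × ∣ S ∣ ≡ m)
  sized? m = anySubset? (λ S → resolving? G r S ×-dec (∣ S ∣ ℕ.≟ m))

subset-injection : ∀ {n k} (p : Subset n) → k ≤ ∣ p ∣ →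
  Σ (Fin k → Fin n) λ f → Injective _≡_ _≡_ f × ∀ i → f i ∈ p
subset-injection {k = zero}  p           _         = (λ ()) , (λ { {()} }) , λ ()
subset-injection {k = suc k} (true ∷ p)  (s≤s k≤p) =
  let f , f-injective , f∈p = subset-injection p k≤p
      g : Fin (suc k) → Fin _
      g = λ { zero → zero ; (suc i) → suc (f i) }
      g-injective : Injective _≡_ _≡_ g
      g-injective = λ { {zero} {zero} _ → refl ; {suc i} {suc j} e → cong suc (f-injective (suc-injective e)) }
  in g , g-injective , λ { zero → here ; (suc i) → there (f∈p i) }
subset-injection {k = suc k} (false ∷ p) k<p       =
  let f , f-injective , f∈p = subset-injection p k<p
  in suc ∘ f , f-injective ∘ suc-injective , there ∘ f∈p

HiddenPairs : ∀ {n} → Graph n → ℕ → ℕ → Set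
HiddenPairs {n} G r m = (f : Fin m → Fin n) → Injective _≡_ _≡_ f →
  ∃₂ λ i j → i ≢ j × ∀ v → (∀ l → v ≢ f l) → distR G r v (f i) ≡ distR G r v (f j)

resolving-size : ∀ {n} (G : Graph n) r {k S} → HiddenPairs G r (suc k) → Resolving G r S →
  n ≤ k + ∣ S ∣
resolving-size {n} G r {k} {S} hidden R with suc k ≤? ∣ ∁ S ∣
... | no  k≮∣∁S∣ = begin
  n                 ≡⟨ sym (ℕ.m∸n+n≡m (∣p∣≤n S)) ⟩
  n ∸ ∣ S ∣ + ∣ S ∣ ≡⟨ cong (_+ ∣ S ∣) (sym (∣∁p∣≡n∸∣p∣ S)) ⟩
  ∣ ∁ S ∣ + ∣ S ∣   ≤⟨ ℕ.+-monoˡ-≤ ∣ S ∣ (ℕ.≤-pred (ℕ.≰⇒> k≮∣∁S∣)) ⟩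
  k + ∣ S ∣         ∎
  where open ℕ.≤-Reasoning
... | yes k<∣∁S∣ =
  let f , f-injective , f∉S = subset-injection (∁ S) k<∣∁S∣
      i , j , i≢j , hidden-ij = hidden f f-injective
      v , v∈S , separates = R (f i) (f j) (i≢j ∘ f-injective)
  in ⊥-elim (separates (hidden-ij v λ l v≡fl → x∈∁p⇒x∉p (f∉S l) (subst (_∈ S) v≡fl v∈S)))

resolving-nonempty : ∀ {n} (G : Graph n) r {S} → 2 ≤ n → Resolving G r S → 1 ≤ ∣ S ∣
resolving-nonempty G r (s≤s (s≤s _)) R =
  let v , v∈S , _ = R zero (suc zero) (λ ())
  in ℕ.≤-trans (s≤s z≤n) (x∈p⇒∣p-x∣<∣p∣ v∈S)

module _ {n} (G : Graph n) where

  hiddenPairs₀ : HiddenPairs G 0 2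
  hiddenPairs₀ _ _ = # 0 , # 1 , (λ ()) , λ v v∉f →
    trans (distR₀ G (v∉f (# 0))) (sym (distR₀ G (v∉f (# 1))))

  distR₁-twinsExcept : ∀ {a b c v} → TwinsExcept G c a b → v ≢ a → v ≢ b → v ≢ c →
    distR G 1 v a ≡ distR G 1 v b
  distR₁-twinsExcept t v≢a v≢b v≢c = distR₁-≡ G v≢a v≢b (t _ v≢a v≢b v≢c)

  hiddenPairs₁ : TwinnedTriples G → HiddenPairs G 1 3
  hiddenPairs₁ twinned f f-injective
    with twinned (f (# 0)) (f (# 1)) (f (# 2))
                 ((λ ()) ∘ f-injective) ((λ ()) ∘ f-injective) ((λ ()) ∘ f-injective)
  ... | inj₁ t        = # 0 , # 1 , (λ ()) , λ v v∉f →
    distR₁-twinsExcept t (v∉f (# 0)) (v∉f (# 1)) (v∉f (# 2))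
  ... | inj₂ (inj₁ t) = # 0 , # 2 , (λ ()) , λ v v∉f →
    distR₁-twinsExcept t (v∉f (# 0)) (v∉f (# 2)) (v∉f (# 1))
  ... | inj₂ (inj₂ t) = # 1 , # 2 , (λ ()) , λ v v∉f →
    distR₁-twinsExcept t (v∉f (# 1)) (v∉f (# 2)) (v∉f (# 0))

  hiddenPairs-twins : TwinnedQuadruples G → ∀ r → HiddenPairs G r 4
  hiddenPairs-twins quadruples r f f-injective =
    let i , j , i≢j , fi≈fj = quadruples f f-injective
    in i , j , i≢j , λ v v∉f → distR-twins G fi≈fj (v∉f i) (v∉f j) r

  resolving₁ : ∀ S → (∀ {p q} → p ∉ S → q ∉ S → p ≢ q → ∃ λ u → u ∈ S × adj G u p ≢ adj G u q) →
    Resolving G 1 S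
  resolving₁ S separated p q p≢q with p ∈? S | q ∈? S
  ... | yes p∈S | _       = p , p∈S , distR-separates-self G 1 p≢q
  ... | no _    | yes q∈S = q , q∈S , distR-separates-self G 1 (p≢q ∘ sym) ∘ sym
  ... | no p∉S  | no q∉S  =
    let u , u∈S , d = separated p∉S q∉S p≢q
        u≢ : ∀ {w} → w ∉ S → u ≢ w
        u≢ w∉S u≡w = w∉S (subst (_∈ S) u≡w u∈S)
    in u , u∈S , distR₁-≢ G (u≢ p∉S) (u≢ q∉S) d

  resolving₀-all-but-one : ∀ v → Resolving G 0 (∁ ⁅ v ⁆)
  resolving₀-all-but-one v x y x≢y with x ∈? ∁ ⁅ v ⁆
  ... | yes x∈S = x , x∈S , distR-separates-self G 0 x≢y
  ... | no x∉S with x∈⁅y⁆⇒x≡y v (x∉∁p⇒x∈p x∉S)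
  ... | refl = y , x∉p⇒x∈∁p (x≢y⇒x∉⁅y⁆ (x≢y ∘ sym)) , distR-separates-self G 0 (x≢y ∘ sym) ∘ sym

ThDimAtLeast : ∀ {n} → Graph n → ℕ → Set
ThDimAtLeast G t = ∀ r S → Resolving G r S → t ≤ r + ∣ S ∣

module _ {n} (G : Graph n) where

  isThDim⇒thDimAtLeast : ∀ {t} → IsThDim G t → ThDimAtLeast G t
  isThDim⇒thDimAtLeast (_ , minimal) r S R =
    let k , dim , k≤∣S∣ = dimR-exists G r R
    in ℕ.≤-trans (minimal r k dim) (ℕ.+-monoʳ-≤ r k≤∣S∣)

  thDimAtLeast⇒isThDim : 1 ≤ n → ThDimAtLeast G (n ∸ 1) → IsThDim G (n ∸ 1)
  thDimAtLeast⇒isThDim 1≤n atLeast =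
    (0 , n ∸ 1 , dim₀ , refl) , λ { r k ((S , R , refl) , _) → atLeast r S R }
    where
    v = fromℕ< 1≤n
    dim₀ : IsDimR G 0 (n ∸ 1)
    dim₀ = (∁ ⁅ v ⁆ , resolving₀-all-but-one G v , trans (∣∁p∣≡n∸∣p∣ ⁅ v ⁆) (cong (n ∸_) (∣⁅x⁆∣≡1 v)))
         , atLeast 0

  twins⇒thDimAtLeast : 2 ≤ n → TwinnedTriples G → TwinnedQuadruples G ⊎ n ≤ 4 → ThDimAtLeast G (n ∸ 1)
  twins⇒thDimAtLeast _ _ _ zero S R = ℕ.∸-monoˡ-≤ 1 (resolving-size G 0 (hiddenPairs₀ G) R)
  twins⇒thDimAtLeast _ twinned _ (suc zero) S R =
    ℕ.∸-monoˡ-≤ 1 (resolving-size G 1 (hiddenPairs₁ G twinned) R)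
  twins⇒thDimAtLeast _ _ (inj₁ quadruples) (suc (suc r)) S R = ℕ.≤-trans
    (ℕ.∸-monoˡ-≤ 1 (resolving-size G (suc (suc r)) (hiddenPairs-twins G quadruples (suc (suc r))) R))
    (s≤s (s≤s (ℕ.m≤n+m ∣ S ∣ r)))
  twins⇒thDimAtLeast 2≤n _ (inj₂ n≤4) (suc (suc r)) S R = ℕ.≤-trans
    (ℕ.∸-monoˡ-≤ 1 n≤4)
    (s≤s (s≤s (ℕ.≤-trans (resolving-nonempty G (suc (suc r)) 2≤n R) (ℕ.m≤n+m ∣ S ∣ r))))

module AllButThree {n} {x y z : Fin n} (x≢y : x ≢ y) (x≢z : x ≢ z) (y≢z : y ≢ z) where

  S : Subset n
  S = ⊤ - x - y - z

  ∈S : ∀ {v} → v ≢ x → v ≢ y → v ≢ z → v ∈ S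
  ∈S v≢x v≢y v≢z = x∈p∧x≢y⇒x∈p-y (x∈p∧x≢y⇒x∈p-y (x∈p∧x≢y⇒x∈p-y ∈⊤ v≢x) v≢y) v≢z

  ∉S : ∀ {v} → v ∉ S → v ≡ x ⊎ v ≡ y ⊎ v ≡ z
  ∉S {v} v∉S with v ≟ x | v ≟ y | v ≟ z
  ... | yes v≡x | _       | _       = inj₁ v≡x
  ... | no _    | yes v≡y | _       = inj₂ (inj₁ v≡y)
  ... | no _    | no _    | yes v≡z = inj₂ (inj₂ v≡z)
  ... | no v≢x  | no v≢y  | no v≢z  = ⊥-elim (v∉S (∈S v≢x v≢y v≢z))

  ∣S∣ : 3 + ∣ S ∣ ≤ n
  ∣S∣ = begin
    3 + ∣ S ∣         ≤⟨ s≤s (s≤s (x∈p⇒∣p-x∣<∣p∣ z∈⊤-x-y)) ⟩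
    2 + ∣ ⊤ - x - y ∣ ≤⟨ s≤s (x∈p⇒∣p-x∣<∣p∣ (x∈p∧x≢y⇒x∈p-y ∈⊤ (x≢y ∘ sym))) ⟩
    1 + ∣ ⊤ - x ∣     ≤⟨ x∈p⇒∣p-x∣<∣p∣ (∈⊤ {x = x}) ⟩
    ∣ ⊤ {n} ∣         ≡⟨ ∣⊤∣≡n n ⟩
    n                 ∎
    where
    open ℕ.≤-Reasoning
    z∈⊤-x-y : z ∈ ⊤ - x - y
    z∈⊤-x-y = x∈p∧x≢y⇒x∈p-y (x∈p∧x≢y⇒x∈p-y ∈⊤ (x≢z ∘ sym)) (y≢z ∘ sym)

thDimAtLeast⇒twinnedTriples : ∀ {n} (G : Graph n) → ThDimAtLeast G (n ∸ 1) → TwinnedTriples G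
thDimAtLeast⇒twinnedTriples G atLeast x y z x≢y x≢z y≢z
  with separator-or-twinsExcept G z x y | separator-or-twinsExcept G y x z | separator-or-twinsExcept G x y z
... | inj₂ t | _      | _      = inj₁ t
... | inj₁ _ | inj₂ t | _      = inj₂ (inj₁ t)
... | inj₁ _ | inj₁ _ | inj₂ t = inj₂ (inj₂ t)
... | inj₁ (u , u≢x , u≢y , u≢z , d) | inj₁ (v , v≢x , v≢z , v≢y , e) | inj₁ (w , w≢y , w≢z , w≢x , f) =
  ⊥-elim (ℕ.1+n≰n (ℕ.≤-trans (ℕ.∸-monoˡ-≤ 1 ∣S∣) (atLeast 1 S (resolving₁ G S separated))))
  where
  open AllButThree x≢y x≢z y≢z
  separated : ∀ {p q} → p ∉ S → q ∉ S → p ≢ q → ∃ λ u → u ∈ S × adj G u p ≢ adj G u q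
  separated p∉S q∉S p≢q with ∉S p∉S | ∉S q∉S
  ... | inj₁ refl        | inj₁ refl        = ⊥-elim (p≢q refl)
  ... | inj₁ refl        | inj₂ (inj₁ refl) = u , ∈S u≢x u≢y u≢z , d
  ... | inj₁ refl        | inj₂ (inj₂ refl) = v , ∈S v≢x v≢y v≢z , e
  ... | inj₂ (inj₁ refl) | inj₁ refl        = u , ∈S u≢x u≢y u≢z , d ∘ sym
  ... | inj₂ (inj₁ refl) | inj₂ (inj₁ refl) = ⊥-elim (p≢q refl)
  ... | inj₂ (inj₁ refl) | inj₂ (inj₂ refl) = w , ∈S w≢x w≢y w≢z , f
  ... | inj₂ (inj₂ refl) | inj₁ refl        = v , ∈S v≢x v≢y v≢z , e ∘ sym
  ... | inj₂ (inj₂ refl) | inj₂ (inj₁ refl) = w , ∈S w≢x w≢y w≢z , f ∘ sym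
  ... | inj₂ (inj₂ refl) | inj₂ (inj₂ refl) = ⊥-elim (p≢q refl)

-- Twins under complementation and isomorphism

module _ {n} (G : Graph n) where

  private
    Ḡ = complement G

  agree-complement : ∀ {u a b} → u ≢ a → u ≢ b → adj G u a ≡ adj G u b → adj Ḡ u a ≡ adj Ḡ u b
  agree-complement u≢a u≢b e =
    trans (adj-complement G u≢a) (trans (cong not e) (sym (adj-complement G u≢b)))

  agree-complement⁻ : ∀ {u a b} → u ≢ a → u ≢ b → adj Ḡ u a ≡ adj Ḡ u b → adj G u a ≡ adj G u b
  agree-complement⁻ u≢a u≢b e =
    Bool.not-injective (trans (sym (adj-complement G u≢a)) (trans e (adj-complement G u≢b)))

  twins-complement⁻ : ∀ {a b} → Twins Ḡ a b → Twins G a b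
  twins-complement⁻ t u u≢a u≢b = agree-complement⁻ u≢a u≢b (t u u≢a u≢b)

  twinsExcept-complement : ∀ {a b c} → TwinsExcept G c a b → TwinsExcept Ḡ c a b
  twinsExcept-complement t u u≢a u≢b u≢c = agree-complement u≢a u≢b (t u u≢a u≢b u≢c)

  twinsExcept-complement⁻ : ∀ {a b c} → TwinsExcept Ḡ c a b → TwinsExcept G c a b
  twinsExcept-complement⁻ t u u≢a u≢b u≢c = agree-complement⁻ u≢a u≢b (t u u≢a u≢b u≢c)

  twinnedTriples-complement : TwinnedTriples G → TwinnedTriples Ḡ
  twinnedTriples-complement twinned x y z x≢y x≢z y≢z =
    Sum.map twinsExcept-complement (Sum.map twinsExcept-complement twinsExcept-complement)
      (twinned x y z x≢y x≢z y≢z)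

  twinnedTriples-complement⁻ : TwinnedTriples Ḡ → TwinnedTriples G
  twinnedTriples-complement⁻ twinned x y z x≢y x≢z y≢z =
    Sum.map twinsExcept-complement⁻ (Sum.map twinsExcept-complement⁻ twinsExcept-complement⁻)
      (twinned x y z x≢y x≢z y≢z)

  twinnedQuadruples-complement⁻ : TwinnedQuadruples Ḡ → TwinnedQuadruples G
  twinnedQuadruples-complement⁻ quadruples f f-injective =
    let i , j , i≢j , t = quadruples f f-injective in i , j , i≢j , twins-complement⁻ t

module _ {n} (G H : Graph n) (G≅H : G ≅ H) where

  private
    σ : Fin n → Fin n
    σ = proj₁ G≅H ⟨$⟩ʳ_
    σ-≢ : ∀ {a b} → a ≢ b → σ a ≢ σ b
    σ-≢ a≢b = a≢b ∘ permutation-injective (proj₁ G≅H)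
    agree-≅ : ∀ {u a b} → adj H (σ u) (σ a) ≡ adj H (σ u) (σ b) → adj G u a ≡ adj G u b
    agree-≅ {u} {a} {b} e = trans (proj₂ G≅H u a) (trans e (sym (proj₂ G≅H u b)))

  twins-≅ : ∀ {a b} → Twins H (σ a) (σ b) → Twins G a b
  twins-≅ t u u≢a u≢b = agree-≅ (t (σ u) (σ-≢ u≢a) (σ-≢ u≢b))

  twinsExcept-≅ : ∀ {a b c} → TwinsExcept H (σ c) (σ a) (σ b) → TwinsExcept G c a b
  twinsExcept-≅ t u u≢a u≢b u≢c = agree-≅ (t (σ u) (σ-≢ u≢a) (σ-≢ u≢b) (σ-≢ u≢c))

  twinnedTriples-≅ : TwinnedTriples H → TwinnedTriples G
  twinnedTriples-≅ twinned x y z x≢y x≢z y≢z =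
    Sum.map twinsExcept-≅ (Sum.map twinsExcept-≅ twinsExcept-≅)
      (twinned (σ x) (σ y) (σ z) (σ-≢ x≢y) (σ-≢ x≢z) (σ-≢ y≢z))

  twinnedQuadruples-≅ : TwinnedQuadruples H → TwinnedQuadruples G
  twinnedQuadruples-≅ quadruples f f-injective =
    let i , j , i≢j , t = quadruples (σ ∘ f) (f-injective ∘ permutation-injective (proj₁ G≅H))
    in i , j , i≢j , twins-≅ t

-- Twins in the graphs of the family

colouring⇒twinnedQuadruples : ∀ {n} (G : Graph n) (c : Fin n → Fin 3) →
  (∀ {a b} → a ≢ b → c a ≡ c b → Twins G a b) → TwinnedQuadruples G
colouring⇒twinnedQuadruples G c twins-of-colour f f-injective =
  let i , j , i<j , same = pigeonhole (ℕ.n<1+n 3) (c ∘ f)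
  in i , j , <⇒≢ i<j , twins-of-colour (<⇒≢ i<j ∘ f-injective) same

bitColour : Bool → Fin 3
bitColour true  = # 1
bitColour false = # 2

bitColour-injective : ∀ {s t} → bitColour s ≡ bitColour t → s ≡ t
bitColour-injective {true}  {true}  _ = refl
bitColour-injective {false} {false} _ = refl

blockAdj : Bool → Bool → Bool → Bool → Bool
blockAdj a _ true  true  = a
blockAdj _ b false false = b
blockAdj _ _ _     _     = false

module _ {n p : ℕ} {a b : Bool} where

  private
    T = twoParts n p a b
    side : Fin n → Bool
    side i = toℕ i <ᵇ p

  adj-twoParts : ∀ {i j} → i ≢ j → adj T i j ≡ blockAdj a b (side i) (side j)
  adj-twoParts {i} {j} i≢j rewrite eqb-toℕ-≢ i≢j = symmetrised (side i) (side j)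
    where
    symmetrised : ∀ s t → ((s ∧ t ∧ a) ∨ (not s ∧ not t ∧ b)) ∨ ((t ∧ s ∧ a) ∨ (not t ∧ not s ∧ b))
                          ≡ blockAdj a b s t
    symmetrised true  true  = trans (Bool.∨-idem _) (Bool.∨-identityʳ a)
    symmetrised false false = Bool.∨-idem b
    symmetrised true  false = refl
    symmetrised false true  = refl

  twoParts-twins : ∀ {x y} → side x ≡ side y → Twins T x y
  twoParts-twins {x} {y} same u u≢x u≢y =
    trans (adj-twoParts u≢x) (trans (cong (blockAdj a b (side u)) same) (sym (adj-twoParts u≢y)))

  twoParts-twinnedTriples : TwinnedTriples T
  twoParts-twinnedTriples x y z _ _ _ =
    Sum.map twinsExcept (Sum.map twinsExcept twinsExcept) (bool-pigeonhole (side x) (side y) (side z))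
    where
    twinsExcept : ∀ {x y w} → side x ≡ side y → TwinsExcept T w x y
    twinsExcept = twins⇒twinsExcept T ∘ twoParts-twins

  twoParts-twinnedQuadruples : TwinnedQuadruples T
  twoParts-twinnedQuadruples =
    colouring⇒twinnedQuadruples T (bitColour ∘ side) λ _ → twoParts-twins ∘ bitColour-injective

module _ {n m : ℕ} where

  private
    S = starPlusIsolated (suc n) m
    leaf : Fin (suc n) → Bool
    leaf v = toℕ v <ᵇ suc m

  adj-star-centre : ∀ {v} → v ≢ zero → adj S zero v ≡ leaf v
  adj-star-centre {zero}  0≢0 = ⊥-elim (0≢0 refl)
  adj-star-centre {suc v} _   = Bool.∨-identityʳ (leaf (suc v))

  adj-star-rim : ∀ {u v} → u ≢ zero → v ≢ zero → adj S u v ≡ false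
  adj-star-rim {zero}          0≢0 _   = ⊥-elim (0≢0 refl)
  adj-star-rim {suc _} {zero}  _   0≢0 = ⊥-elim (0≢0 refl)
  adj-star-rim {suc u} {suc v} _   _   with u ≟ v
  ... | yes refl = irrefl S (suc u)
  ... | no u≢v rewrite eqb-≢ (u≢v ∘ toℕ-injective) = refl

  private
    rim-agrees : ∀ {a b} w → a ≢ zero → b ≢ zero → adj S (suc w) a ≡ adj S (suc w) b
    rim-agrees w a≢0 b≢0 = trans (adj-star-rim {suc w} (λ ()) a≢0) (sym (adj-star-rim {suc w} (λ ()) b≢0))

  star-twins : ∀ {a b} → a ≢ zero → b ≢ zero → leaf a ≡ leaf b → Twins S a b
  star-twins a≢0 b≢0 same zero    _ _ = trans (adj-star-centre a≢0) (trans same (sym (adj-star-centre b≢0)))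
  star-twins a≢0 b≢0 _    (suc w) _ _ = rim-agrees w a≢0 b≢0

  star-twinsExcept-centre : ∀ {a b} → a ≢ zero → b ≢ zero → TwinsExcept S zero a b
  star-twinsExcept-centre a≢0 b≢0 zero    _ _ 0≢0 = ⊥-elim (0≢0 refl)
  star-twinsExcept-centre a≢0 b≢0 (suc w) _ _ _   = rim-agrees w a≢0 b≢0

  star-twinnedTriples : TwinnedTriples S
  star-twinnedTriples zero    zero    _       x≢y _   _   = ⊥-elim (x≢y refl)
  star-twinnedTriples zero    (suc _) zero    _   x≢z _   = ⊥-elim (x≢z refl)
  star-twinnedTriples (suc _) zero    zero    _   _   y≢z = ⊥-elim (y≢z refl)
  star-twinnedTriples zero    (suc _) (suc _) _   _   _   = inj₂ (inj₂ (star-twinsExcept-centre (λ ()) (λ ())))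
  star-twinnedTriples (suc _) zero    (suc _) _   _   _   = inj₂ (inj₁ (star-twinsExcept-centre (λ ()) (λ ())))
  star-twinnedTriples (suc _) (suc _) zero    _   _   _   = inj₁ (star-twinsExcept-centre (λ ()) (λ ()))
  star-twinnedTriples (suc x) (suc y) (suc z) _   _   _   =
    Sum.map twinsExcept (Sum.map twinsExcept twinsExcept)
      (bool-pigeonhole (leaf (suc x)) (leaf (suc y)) (leaf (suc z)))
    where
    twinsExcept : ∀ {a b w} → leaf (suc a) ≡ leaf (suc b) → TwinsExcept S w (suc a) (suc b)
    twinsExcept = twins⇒twinsExcept S ∘ star-twins (λ ()) (λ ())

  star-twinnedQuadruples : TwinnedQuadruples S
  star-twinnedQuadruples = colouring⇒twinnedQuadruples S colour twins-of-colour
    where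
    colour : Fin (suc n) → Fin 3
    colour zero    = # 0
    colour (suc v) = bitColour (leaf (suc v))
    twins-of-colour : ∀ {a b} → a ≢ b → colour a ≡ colour b → Twins S a b
    twins-of-colour {zero}  {zero}  a≢b _ = ⊥-elim (a≢b refl)
    twins-of-colour {zero}  {suc b} _   e with leaf (suc b)
    ... | true  = case e of λ ()
    ... | false = case e of λ ()
    twins-of-colour {suc a} {zero}  _   e with leaf (suc a)
    ... | true  = case e of λ ()
    ... | false = case e of λ ()
    twins-of-colour {suc a} {suc b} _   e = star-twins (λ ()) (λ ()) (bitColour-injective e)

path₄-twinnedTriples : TwinnedTriples (pathGraph 4)
path₄-twinnedTriples = from-yes (twinnedTriples? (pathGraph 4))

inFamily⇒twins : ∀ {n} (G : Graph n) → InFamily G →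
  TwinnedTriples G × (TwinnedQuadruples G ⊎ n ≤ 4)
inFamily⇒twins {zero}  G (inj₁ (_ , _ , () , _))
inFamily⇒twins {suc n} G (inj₁ (m , _ , _ , G≅S)) =
  twinnedTriples-≅ G S G≅S star-twinnedTriples , inj₁ (twinnedQuadruples-≅ G S G≅S star-twinnedQuadruples)
  where S = starPlusIsolated (suc n) m
inFamily⇒twins {n} G (inj₂ (inj₁ (p , a , b , _ , G≅T))) =
  twinnedTriples-≅ G T G≅T (twoParts-twinnedTriples {p = p} {a} {b}) ,
  inj₁ (twinnedQuadruples-≅ G T G≅T (twoParts-twinnedQuadruples {p = p} {a} {b}))
  where T = twoParts n p a b
inFamily⇒twins G (inj₂ (inj₂ (refl , G≅P))) =
  twinnedTriples-≅ G (pathGraph 4) G≅P path₄-twinnedTriples , inj₂ ℕ.≤-refl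

InFamilyOrComplement : ∀ {n} → Graph n → Set
InFamilyOrComplement G = InFamily G ⊎ InFamily (complement G)

inFamilyOrComplement⇒twins : ∀ {n} (G : Graph n) → InFamilyOrComplement G →
  TwinnedTriples G × (TwinnedQuadruples G ⊎ n ≤ 4)
inFamilyOrComplement⇒twins G (inj₁ G∈F) = inFamily⇒twins G G∈F
inFamilyOrComplement⇒twins G (inj₂ Ḡ∈F) =
  let twinned , quadruples = inFamily⇒twins (complement G) Ḡ∈F
  in twinnedTriples-complement⁻ G twinned , Sum.map₁ (twinnedQuadruples-complement⁻ G) quadruples

-- Graphs with twinned triples belong to the family

count : ∀ {n} → (Fin n → Bool) → ℕ
count {zero}  P = 0
count {suc n} P = if P zero then suc (count (P ∘ suc)) else count (P ∘ suc)

count≤n : ∀ {n} (P : Fin n → Bool) → count P ≤ n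
count≤n {zero}  P = z≤n
count≤n {suc n} P with P zero
... | true  = s≤s (count≤n (P ∘ suc))
... | false = ℕ.m≤n⇒m≤1+n (count≤n (P ∘ suc))

count-pos : ∀ {n} (P : Fin n → Bool) {i} → P i ≡ true → 1 ≤ count P
count-pos P {zero}  Pi rewrite Pi = s≤s z≤n
count-pos P {suc i} Pi with P zero
... | true  = s≤s z≤n
... | false = count-pos (P ∘ suc) Pi

count≥2 : ∀ {n} (P : Fin n → Bool) {i j} → P i ≡ true → P j ≡ true → i ≢ j → 2 ≤ count P
count≥2 P {zero}  {zero}  _  _  i≢j = ⊥-elim (i≢j refl)
count≥2 P {zero}  {suc j} Pi Pj _   rewrite Pi = s≤s (count-pos (P ∘ suc) Pj)
count≥2 P {suc i} {zero}  Pi Pj _   rewrite Pj = s≤s (count-pos (P ∘ suc) Pi)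
count≥2 P {suc i} {suc j} Pi Pj i≢j with P zero
... | true  = ℕ.m≤n⇒m≤1+n (count≥2 (P ∘ suc) Pi Pj (i≢j ∘ cong suc))
... | false = count≥2 (P ∘ suc) Pi Pj (i≢j ∘ cong suc)

<ᵇ-irrefl : ∀ m → (m <ᵇ m) ≡ false
<ᵇ-irrefl zero    = refl
<ᵇ-irrefl (suc m) = <ᵇ-irrefl m

punchIn-<ᵇ : ∀ {m c} (j : Fin (suc m)) k → toℕ j ≡ c → (toℕ (punchIn j k) <ᵇ c) ≡ (toℕ k <ᵇ c)
punchIn-<ᵇ zero    k       refl = refl
punchIn-<ᵇ (suc j) zero    refl = refl
punchIn-<ᵇ (suc j) (suc k) refl = punchIn-<ᵇ j k refl

sortBy : ∀ {n} (P : Fin n → Bool) →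
  Σ (Permutation n n) λ σ → ∀ i → (toℕ (σ ⟨$⟩ʳ i) <ᵇ count P) ≡ P i
sortBy {zero}  P = Permutation.id , λ ()
sortBy {suc n} P with sortBy (P ∘ suc) | P zero in P0
... | σ , sorted | true  = insert zero zero σ , sorted′
  where
  sorted′ : ∀ i → (toℕ (insert zero zero σ ⟨$⟩ʳ i) <ᵇ suc (count (P ∘ suc))) ≡ P i
  sorted′ zero    = sym P0
  sorted′ (suc i) =
    trans (cong (λ k → toℕ k <ᵇ suc (count (P ∘ suc))) (insert-punchIn zero zero σ i)) (sorted i)
... | σ , sorted | false = insert zero j σ , sorted′
  where
  c = count (P ∘ suc)
  j : Fin (suc n)
  j = fromℕ< (s≤s (count≤n (P ∘ suc)))
  sorted′ : ∀ i → (toℕ (insert zero j σ ⟨$⟩ʳ i) <ᵇ c) ≡ P i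
  sorted′ zero    = trans (cong (_<ᵇ c) (toℕ-fromℕ< _)) (trans (<ᵇ-irrefl c) (sym P0))
  sorted′ (suc i) = begin
    toℕ (insert zero j σ ⟨$⟩ʳ suc i) <ᵇ c ≡⟨ cong (λ k → toℕ k <ᵇ c) (insert-punchIn zero j σ i) ⟩
    toℕ (punchIn j (σ ⟨$⟩ʳ i)) <ᵇ c       ≡⟨ punchIn-<ᵇ j (σ ⟨$⟩ʳ i) (toℕ-fromℕ< _) ⟩
    toℕ (σ ⟨$⟩ʳ i) <ᵇ c                   ≡⟨ sorted i ⟩
    P (suc i)                            ∎
    where open ≡-Reasoning

transpose-source : ∀ {n} (i j : Fin n) → PC.transpose i j i ≡ j
transpose-source i j rewrite dec-true (i ≟ i) refl = refl

transpose-invariant : ∀ {n} {A : Set} (Q : Fin n → A) {i j} → Q i ≡ Q j →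
  ∀ k → Q (PC.transpose i j k) ≡ Q k
transpose-invariant Q {i} {j} Qi≡Qj k with k ≟ i
... | yes refl = sym Qi≡Qj
... | no _ with k ≟ j
...   | yes refl = Qi≡Qj
...   | no _     = refl

sortBy-from : ∀ {n} (P : Fin (suc n) → Bool) {z} → P z ≡ true →
  Σ (Permutation (suc n) (suc n)) λ σ → σ ⟨$⟩ʳ z ≡ zero × ∀ i → (toℕ (σ ⟨$⟩ʳ i) <ᵇ count P) ≡ P i
sortBy-from {n} P {z} Pz =
  σ ∘ₚ transpose (σ ⟨$⟩ʳ z) zero , transpose-source (σ ⟨$⟩ʳ z) zero ,
  λ i → trans (transpose-invariant inFront (trans (sorted z) (trans Pz (sym front-nonempty))) (σ ⟨$⟩ʳ i))
              (sorted i)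
  where
  σ = proj₁ (sortBy P)
  sorted = proj₂ (sortBy P)
  inFront : Fin (suc n) → Bool
  inFront k = toℕ k <ᵇ count P
  front-nonempty : inFront zero ≡ true
  front-nonempty with count P | count-pos P Pz
  ... | suc _ | _ = refl

twoParts-≅ : ∀ {n} (H : Graph n) (P : Fin n → Bool) (c : Bool → Bool → Bool) →
  (∀ i j → i ≢ j → adj H i j ≡ c (P i) (P j)) → c true false ≡ false →
  H ≅ twoParts n (count P) (c true true) (c false false)
twoParts-≅ {n} H P c adj-H cross = σ , preserves
  where
  σ = proj₁ (sortBy P)
  sorted = proj₂ (sortBy P)
  T = twoParts n (count P) (c true true) (c false false)
  blocks : ∀ i j → i ≢ j → adj H i j ≡ blockAdj (c true true) (c false false) (P i) (P j)
  blocks i j i≢j with P i in Pi | P j in Pj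
  ... | true  | true  = trans (adj-H i j i≢j) (cong₂ c Pi Pj)
  ... | false | false = trans (adj-H i j i≢j) (cong₂ c Pi Pj)
  ... | true  | false = trans (adj-H i j i≢j) (trans (cong₂ c Pi Pj) cross)
  ... | false | true  = trans (adj-sym H i j) (trans (adj-H j i (i≢j ∘ sym)) (trans (cong₂ c Pj Pi) cross))
  preserves : ∀ i j → adj H i j ≡ adj T (σ ⟨$⟩ʳ i) (σ ⟨$⟩ʳ j)
  preserves i j with i ≟ j
  ... | yes refl = trans (irrefl H i) (sym (irrefl T (σ ⟨$⟩ʳ i)))
  ... | no i≢j   = begin
    adj H i j                                                    ≡⟨ blocks i j i≢j ⟩
    blockAdj (c true true) (c false false) (P i) (P j)            ≡⟨ sym (cong₂ (blockAdj _ _) (sorted i) (sorted j)) ⟩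
    blockAdj (c true true) (c false false) (toℕ (σ ⟨$⟩ʳ i) <ᵇ count P) (toℕ (σ ⟨$⟩ʳ j) <ᵇ count P)
      ≡⟨ sym (adj-twoParts {p = count P} (i≢j ∘ permutation-injective σ)) ⟩
    adj T (σ ⟨$⟩ʳ i) (σ ⟨$⟩ʳ j)                                    ∎
    where open ≡-Reasoning

star-≅ : ∀ {n} (H : Graph n) {z x} → adj H z x ≡ true → (∀ i j → i ≢ z → j ≢ z → adj H i j ≡ false) →
  ∃ λ m → 1 ≤ m × suc m ≤ n × H ≅ starPlusIsolated n m
star-≅ {zero}  _ {z} = ⊥-elim (¬Fin0 z)
star-≅ {suc n} H {z} {x} zx rim-edgeless =
  m , ℕ.∸-monoˡ-≤ 1 2≤c , subst (_≤ suc n) (sym suc-m) (count≤n closed) , σ , preserves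
  where
  closed : Fin (suc n) → Bool
  closed i = does (i ≟ z) ∨ adj H z i
  closed-z : closed z ≡ true
  closed-z rewrite dec-true (z ≟ z) refl = refl
  closed-≢ : ∀ {i} → i ≢ z → closed i ≡ adj H z i
  closed-≢ {i} i≢z rewrite dec-false (i ≟ z) i≢z = refl
  σ = proj₁ (sortBy-from closed closed-z)
  σz = proj₁ (proj₂ (sortBy-from closed closed-z))
  sorted = proj₂ (proj₂ (sortBy-from closed closed-z))
  2≤c : 2 ≤ count closed
  2≤c = count≥2 closed closed-z (trans (closed-≢ (adj⇒≢ H zx ∘ sym)) zx) (adj⇒≢ H zx)
  m = count closed ∸ 1
  suc-m : suc m ≡ count closed
  suc-m = trans (ℕ.+-comm 1 m) (ℕ.m∸n+n≡m (ℕ.≤-trans (s≤s z≤n) 2≤c))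
  S = starPlusIsolated (suc n) m
  σ≢0 : ∀ {i} → i ≢ z → σ ⟨$⟩ʳ i ≢ zero
  σ≢0 i≢z σi≡0 = i≢z (permutation-injective σ (trans σi≡0 (sym σz)))
  from-centre : ∀ j → j ≢ z → adj H z j ≡ adj S (σ ⟨$⟩ʳ z) (σ ⟨$⟩ʳ j)
  from-centre j j≢z = begin
    adj H z j                       ≡⟨ sym (closed-≢ j≢z) ⟩
    closed j                        ≡⟨ sym (sorted j) ⟩
    toℕ (σ ⟨$⟩ʳ j) <ᵇ count closed   ≡⟨ cong (toℕ (σ ⟨$⟩ʳ j) <ᵇ_) (sym suc-m) ⟩
    toℕ (σ ⟨$⟩ʳ j) <ᵇ suc m          ≡⟨ sym (adj-star-centre (σ≢0 j≢z)) ⟩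
    adj S zero (σ ⟨$⟩ʳ j)            ≡⟨ cong (λ v → adj S v (σ ⟨$⟩ʳ j)) (sym σz) ⟩
    adj S (σ ⟨$⟩ʳ z) (σ ⟨$⟩ʳ j)       ∎
    where open ≡-Reasoning
  preserves : ∀ i j → adj H i j ≡ adj S (σ ⟨$⟩ʳ i) (σ ⟨$⟩ʳ j)
  preserves i j with i ≟ z | j ≟ z
  ... | yes refl | yes refl = trans (irrefl H z) (sym (irrefl S (σ ⟨$⟩ʳ z)))
  ... | yes refl | no j≢z   = from-centre j j≢z
  ... | no i≢z   | yes refl =
    trans (adj-sym H i z) (trans (from-centre i i≢z) (adj-sym S (σ ⟨$⟩ʳ z) (σ ⟨$⟩ʳ i)))
  ... | no i≢z   | no j≢z   =
    trans (rim-edgeless i j i≢z j≢z) (sym (adj-star-rim (σ≢0 i≢z) (σ≢0 j≢z)))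

path-≅ : ∀ {n} → n ≡ 4 → (G : Graph n) (g : Fin 4 → Fin n) → Injective _≡_ _≡_ g →
  (∀ v → ∃ λ k → g k ≡ v) → (∀ k l → adj G (g k) (g l) ≡ adj (pathGraph 4) k l) → G ≅ pathGraph n
path-≅ refl G g g-injective onto preserves =
  permutation h g (λ k → g-injective (proj₂ (onto (g k)))) (proj₂ ∘ onto) ,
  λ i j → trans (cong₂ (adj G) (sym (proj₂ (onto i))) (sym (proj₂ (onto j)))) (preserves (h i) (h j))
  where
  h = proj₁ ∘ onto

path₄-neighbourhoods-distinct : ∀ k l → (∀ m → adj (pathGraph 4) k m ≡ adj (pathGraph 4) l m) → k ≡ l
path₄-neighbourhoods-distinct = from-yes
  (all? λ k → all? λ l → all? (λ m → adj (pathGraph 4) k m Bool.≟ adj (pathGraph 4) l m) →-dec k ≟ l)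

pathFamily : ∀ {n} (G : Graph n) {a b c d : Fin n} → (∀ v → v ≡ a ⊎ v ≡ b ⊎ v ≡ c ⊎ v ≡ d) →
  adj G a b ≡ true → adj G b c ≡ true → adj G c d ≡ true →
  adj G a c ≡ false → adj G a d ≡ false → adj G b d ≡ false →
  n ≡ 4 × G ≅ pathGraph n
pathFamily {n} G {a} {b} {c} {d} cover ab bc cd ac ad bd = n≡4 , path-≅ n≡4 G g g-injective onto table
  where
  g : Fin 4 → Fin n
  g zero                   = a
  g (suc zero)             = b
  g (suc (suc zero))       = c
  g (suc (suc (suc zero))) = d
  onto : ∀ v → ∃ λ k → g k ≡ v
  onto v with cover v
  ... | inj₁ refl               = # 0 , refl
  ... | inj₂ (inj₁ refl)        = # 1 , refl
  ... | inj₂ (inj₂ (inj₁ refl)) = # 2 , refl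
  ... | inj₂ (inj₂ (inj₂ refl)) = # 3 , refl
  table : ∀ k l → adj G (g k) (g l) ≡ adj (pathGraph 4) k l
  table zero                   zero                   = irrefl G a
  table zero                   (suc zero)             = ab
  table zero                   (suc (suc zero))       = ac
  table zero                   (suc (suc (suc zero))) = ad
  table (suc zero)             zero                   = trans (adj-sym G b a) ab
  table (suc zero)             (suc zero)             = irrefl G b
  table (suc zero)             (suc (suc zero))       = bc
  table (suc zero)             (suc (suc (suc zero))) = bd
  table (suc (suc zero))       zero                   = trans (adj-sym G c a) ac
  table (suc (suc zero))       (suc zero)             = trans (adj-sym G c b) bc
  table (suc (suc zero))       (suc (suc zero))       = irrefl G c
  table (suc (suc zero))       (suc (suc (suc zero))) = cd
  table (suc (suc (suc zero))) zero                   = trans (adj-sym G d a) ad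
  table (suc (suc (suc zero))) (suc zero)             = trans (adj-sym G d b) bd
  table (suc (suc (suc zero))) (suc (suc zero))       = trans (adj-sym G d c) cd
  table (suc (suc (suc zero))) (suc (suc (suc zero))) = irrefl G d
  g-injective : Injective _≡_ _≡_ g
  g-injective {k} {l} gk≡gl = path₄-neighbourhoods-distinct k l λ m →
    trans (sym (table k m)) (trans (cong (λ v → adj G v (g m)) gk≡gl) (table l m))
  h-injective : Injective _≡_ _≡_ (proj₁ ∘ onto)
  h-injective {v} {w} e = trans (sym (proj₂ (onto v))) (trans (cong g e) (proj₂ (onto w)))
  n≡4 : n ≡ 4
  n≡4 = ℕ.≤-antisym (injective⇒≤ h-injective) (injective⇒≤ g-injective)

module TwoClasses {n} (G : Graph n) (A : Fin n → Bool)
  (twins-within : ∀ {i j} → A i ≡ A j → i ≢ j → Twins G i j) where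

  private
    agree : ∀ {i j u} → A i ≡ A j → u ≢ i → u ≢ j → adj G u i ≡ adj G u j
    agree {i} {j} same u≢i u≢j with i ≟ j
    ... | yes refl = refl
    ... | no i≢j   = twins-within same i≢j _ u≢i u≢j

  adj-classwise : ∀ {i j k l} → A i ≡ A k → A j ≡ A l → i ≢ j → k ≢ l → adj G i j ≡ adj G k l
  adj-classwise {i} {j} {k} {l} ik jl i≢j k≢l with j ≟ k
  ... | no j≢k = begin
    adj G i j ≡⟨ adj-sym G i j ⟩
    adj G j i ≡⟨ agree ik (i≢j ∘ sym) j≢k ⟩
    adj G j k ≡⟨ adj-sym G j k ⟩
    adj G k j ≡⟨ agree jl (j≢k ∘ sym) k≢l ⟩
    adj G k l ∎
    where open ≡-Reasoning
  ... | yes refl with i ≟ l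
  ...   | yes refl = adj-sym G i j
  ...   | no i≢l   = begin
    adj G i j ≡⟨ agree jl i≢j i≢l ⟩
    adj G i l ≡⟨ adj-sym G i l ⟩
    adj G l i ≡⟨ agree ik (i≢l ∘ sym) (k≢l ∘ sym) ⟩
    adj G l j ≡⟨ adj-sym G l j ⟩
    adj G j l ∎
    where open ≡-Reasoning

  private
    pair? : ∀ s t → Dec (∃₂ λ i j → A i ≡ s × A j ≡ t × i ≢ j)
    pair? s t = any? λ i → any? λ j → (A i Bool.≟ s) ×-dec (A j Bool.≟ t) ×-dec ¬? (i ≟ j)

  classAdj : Bool → Bool → Bool
  classAdj s t with pair? s t
  ... | yes (i , j , _) = adj G i j
  ... | no _            = false

  adj-classAdj : ∀ i j → i ≢ j → adj G i j ≡ classAdj (A i) (A j)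
  adj-classAdj i j i≢j with pair? (A i) (A j)
  ... | yes (k , l , Ak , Al , k≢l) = adj-classwise (sym Ak) (sym Al) i≢j k≢l
  ... | no none                     = ⊥-elim (none (i , j , refl , refl , i≢j))

  inFamilyOrComplement : InFamilyOrComplement G
  inFamilyOrComplement with classAdj true false in cross
  ... | false = inj₁ (inj₂ (inj₁ (count A , _ , _ , count≤n A , twoParts-≅ G A classAdj adj-classAdj cross)))
  ... | true  = inj₂ (inj₂ (inj₁ (count A , _ , _ , count≤n A ,
    twoParts-≅ (complement G) A (λ s t → not (classAdj s t))
      (λ i j i≢j → trans (adj-complement G i≢j) (cong not (adj-classAdj i j i≢j))) (cong not cross))))

-- Here z separates x from y, which are twins apart from z, and u below separates x from z. If u ≁ x, then G - z is edgeless;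
-- otherwise there is no vertex outside {x, y, z, u}, and z x u y is an induced path.
module StarOrPath {n} (G : Graph n) (twinned : TwinnedTriples G) {x y z : Fin n}
  (x≢y : x ≢ y) (x≢z : x ≢ z) (y≢z : y ≢ z)
  (zx : adj G z x ≡ true) (zy : adj G z y ≡ false) (xy : adj G x y ≡ false)
  (x≈y : TwinsExcept G z x y) (x≁z : ¬ Twins G x z) where

  Outside : Fin n → Set
  Outside w = w ≢ x × w ≢ y × w ≢ z

  outside-like-x : ∀ {w w′} → Outside w → Outside w′ → w′ ≢ w → adj G w′ w ≡ adj G w′ x
  outside-like-x {w} {w′} (w≢x , w≢y , w≢z) (w′≢x , w′≢y , w′≢z) w′≢w
    with twinned x y w x≢y (w≢x ∘ sym) (w≢y ∘ sym)
  ... | inj₁ x≈y-off-w  = ⊥-elim (bool-clash zx zy (x≈y-off-w z (x≢z ∘ sym) (y≢z ∘ sym) (w≢z ∘ sym)))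
  ... | inj₂ (inj₁ x≈w) = sym (x≈w w′ w′≢x w′≢w w′≢y)
  ... | inj₂ (inj₂ y≈w) = trans (sym (y≈w w′ w′≢y w′≢w w′≢x)) (sym (x≈y w′ w′≢x w′≢y w′≢z))

  private
    separator = ¬twins⇒separator G x≁z
    u = proj₁ separator
    u≢x = proj₁ (proj₂ separator)
    u≢z = proj₁ (proj₂ (proj₂ separator))
    u-separates = proj₂ (proj₂ (proj₂ separator))

    yx : adj G y x ≡ false
    yx = trans (adj-sym G y x) xy
    yz : adj G y z ≡ false
    yz = trans (adj-sym G y z) zy

    u≢y : u ≢ y
    u≢y u≡y = u-separates (subst (λ v → adj G v x ≡ adj G v z) (sym u≡y) (trans yx (sym yz)))

    u-outside : Outside u
    u-outside = u≢x , u≢y , u≢z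

  outside-sees-x-like-u : ∀ {w} → Outside w → adj G w x ≡ adj G u x
  outside-sees-x-like-u {w} w-outside with w ≟ u
  ... | yes refl = refl
  ... | no w≢u   = begin
    adj G w x ≡⟨ sym (outside-like-x u-outside w-outside w≢u) ⟩
    adj G w u ≡⟨ adj-sym G w u ⟩
    adj G u w ≡⟨ outside-like-x w-outside u-outside (w≢u ∘ sym) ⟩
    adj G u x ∎
    where open ≡-Reasoning

  classify : ∀ {v} → v ≢ z → v ≡ x ⊎ v ≡ y ⊎ Outside v
  classify {v} v≢z with v ≟ x | v ≟ y
  ... | yes v≡x | _       = inj₁ v≡x
  ... | no _    | yes v≡y = inj₂ (inj₁ v≡y)
  ... | no v≢x  | no v≢y  = inj₂ (inj₂ (v≢x , v≢y , v≢z))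

  rim-edgeless : adj G u x ≡ false → ∀ {i j} →
    i ≡ x ⊎ i ≡ y ⊎ Outside i → j ≡ x ⊎ j ≡ y ⊎ Outside j → adj G i j ≡ false
  rim-edgeless ux = edgeless
    where
    x-isolated : ∀ {w} → Outside w → adj G w x ≡ false
    x-isolated w-outside = trans (outside-sees-x-like-u w-outside) ux
    y-isolated : ∀ {w} → Outside w → adj G w y ≡ false
    y-isolated {w} w-outside@(w≢x , w≢y , w≢z) = trans (sym (x≈y w w≢x w≢y w≢z)) (x-isolated w-outside)
    edgeless : ∀ {i j} → i ≡ x ⊎ i ≡ y ⊎ Outside i → j ≡ x ⊎ j ≡ y ⊎ Outside j → adj G i j ≡ false
    edgeless (inj₁ refl)         (inj₁ refl)         = irrefl G x
    edgeless (inj₁ refl)         (inj₂ (inj₁ refl))  = xy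
    edgeless (inj₁ refl)         (inj₂ (inj₂ j-out)) = trans (adj-sym G x _) (x-isolated j-out)
    edgeless (inj₂ (inj₁ refl))  (inj₁ refl)         = yx
    edgeless (inj₂ (inj₁ refl))  (inj₂ (inj₁ refl))  = irrefl G y
    edgeless (inj₂ (inj₁ refl))  (inj₂ (inj₂ j-out)) = trans (adj-sym G y _) (y-isolated j-out)
    edgeless (inj₂ (inj₂ i-out)) (inj₁ refl)         = x-isolated i-out
    edgeless (inj₂ (inj₂ i-out)) (inj₂ (inj₁ refl))  = y-isolated i-out
    edgeless {i} {j} (inj₂ (inj₂ i-out)) (inj₂ (inj₂ j-out)) with i ≟ j
    ... | yes refl = irrefl G i
    ... | no i≢j   = trans (outside-like-x j-out i-out i≢j) (x-isolated i-out)

  module Path (ux : adj G u x ≡ true) where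

    xz : adj G x z ≡ true
    xz = trans (adj-sym G x z) zx
    xu : adj G x u ≡ true
    xu = trans (adj-sym G x u) ux
    uz : adj G u z ≡ false
    uz = trans (Bool.¬-not (u-separates ∘ sym)) (cong not ux)
    zu : adj G z u ≡ false
    zu = trans (adj-sym G z u) uz
    uy : adj G u y ≡ true
    uy = trans (sym (x≈y u u≢x u≢y u≢z)) ux

    outside-sees-x : ∀ {w} → Outside w → adj G w x ≡ true
    outside-sees-x w-outside = trans (outside-sees-x-like-u w-outside) ux

    outside-sees-u : ∀ {w} → Outside w → w ≢ u → adj G w u ≡ true
    outside-sees-u w-outside w≢u = trans (outside-like-x u-outside w-outside w≢u) (outside-sees-x w-outside)

    y-sees-outside : ∀ {w} → Outside w → adj G y w ≡ true
    y-sees-outside {w} w-outside@(w≢x , w≢y , w≢z) =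
      trans (adj-sym G y w) (trans (sym (x≈y w w≢x w≢y w≢z)) (outside-sees-x w-outside))

    no-fifth-vertex : ∀ {w} → Outside w → w ≢ u → ⊥
    no-fifth-vertex {w} w-outside@(w≢x , w≢y , w≢z) w≢u with adj G z w in zw
    ... | false with twinned z y u (y≢z ∘ sym) (u≢z ∘ sym) (u≢y ∘ sym)
    ...   | inj₁ z≈y        = bool-clash xz xy (z≈y x x≢z x≢y (u≢x ∘ sym))
    ...   | inj₂ (inj₁ z≈u) = bool-clash (outside-sees-u w-outside w≢u) (trans (adj-sym G w z) zw)
                                         (sym (z≈u w w≢z w≢u w≢y))
    ...   | inj₂ (inj₂ y≈u) = bool-clash xu xy (sym (y≈u x x≢y (u≢x ∘ sym) x≢z))
    no-fifth-vertex {w} w-outside@(w≢x , w≢y , w≢z) w≢u | true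
      with twinned x z w x≢z (w≢x ∘ sym) (w≢z ∘ sym)
    ...   | inj₁ x≈z        = bool-clash ux uz (x≈z u u≢x u≢z (w≢u ∘ sym))
    ...   | inj₂ (inj₁ x≈w) = bool-clash (y-sees-outside w-outside) yx (sym (x≈w y (x≢y ∘ sym) (w≢y ∘ sym) y≢z))
    ...   | inj₂ (inj₂ z≈w) = bool-clash (y-sees-outside w-outside) yz (sym (z≈w y y≢z (w≢y ∘ sym) (x≢y ∘ sym)))

    cover : ∀ v → v ≡ z ⊎ v ≡ x ⊎ v ≡ u ⊎ v ≡ y
    cover v with v ≟ z | v ≟ x | v ≟ u | v ≟ y
    ... | yes v≡z | _       | _       | _       = inj₁ v≡z
    ... | no _    | yes v≡x | _       | _       = inj₂ (inj₁ v≡x)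
    ... | no _    | no _    | yes v≡u | _       = inj₂ (inj₂ (inj₁ v≡u))
    ... | no _    | no _    | no _    | yes v≡y = inj₂ (inj₂ (inj₂ v≡y))
    ... | no v≢z  | no v≢x  | no v≢u  | no v≢y  = ⊥-elim (no-fifth-vertex (v≢x , v≢y , v≢z) v≢u)

  inFamily : InFamily G
  inFamily with adj G u x in ux
  ... | false = inj₁ (star-≅ G zx λ i j i≢z j≢z → rim-edgeless ux (classify i≢z) (classify j≢z))
  ... | true  = inj₂ (inj₂ (pathFamily G cover zx xu uy zu zy xy))
    where open Path ux

module _ {n} (G : Graph n) (twinned : TwinnedTriples G) where

  separatedTwins⇒family : ∀ {x y z} → x ≢ y → x ≢ z → y ≢ z → adj G z x ≡ true → adj G z y ≡ false →
    TwinsExcept G z x y → ¬ Twins G x z → ¬ Twins G y z → InFamilyOrComplement G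
  separatedTwins⇒family {x} {y} {z} x≢y x≢z y≢z zx zy x≈y x≁z y≁z with adj G x y in xy
  ... | false = inj₁ (StarOrPath.inFamily G twinned x≢y x≢z y≢z zx zy xy x≈y x≁z)
  ... | true  = inj₂ (StarOrPath.inFamily (complement G) (twinnedTriples-complement G twinned)
    (x≢y ∘ sym) y≢z x≢z (flip (y≢z ∘ sym) zy) (flip (x≢z ∘ sym) zx) (flip (x≢y ∘ sym) (trans (adj-sym G y x) xy))
    (twinsExcept-complement G (twinsExcept-sym G x≈y)) (y≁z ∘ twins-complement⁻ G))
    where
    flip : ∀ {i j b} → i ≢ j → adj G i j ≡ b → adj (complement G) i j ≡ not b
    flip i≢j e = trans (adj-complement G i≢j) (cong not e)

  nonTwinTriple⇒family : ∀ {a b c} → a ≢ b → a ≢ c → b ≢ c → TwinsExcept G c a b →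
    ¬ Twins G a b → ¬ Twins G a c → ¬ Twins G b c → InFamilyOrComplement G
  nonTwinTriple⇒family {a} {b} {c} a≢b a≢c b≢c a≈b a≁b a≁c b≁c with adj G c a in ca | adj G c b in cb
  ... | true  | false = separatedTwins⇒family a≢b a≢c b≢c ca cb a≈b a≁c b≁c
  ... | false | true  = separatedTwins⇒family (a≢b ∘ sym) b≢c a≢c cb ca (twinsExcept-sym G a≈b) b≁c a≁c
  ... | true  | true  = ⊥-elim (a≁b (twinsExcept⇒twins G a≈b (trans ca (sym cb))))
  ... | false | false = ⊥-elim (a≁b (twinsExcept⇒twins G a≈b (trans ca (sym cb))))

  pairwiseNonTwins⇒family : ∀ {x y z} → x ≢ y → x ≢ z → y ≢ z →
    ¬ Twins G x y → ¬ Twins G x z → ¬ Twins G y z → InFamilyOrComplement G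
  pairwiseNonTwins⇒family {x} {y} {z} x≢y x≢z y≢z x≁y x≁z y≁z with twinned x y z x≢y x≢z y≢z
  ... | inj₁ x≈y        = nonTwinTriple⇒family x≢y x≢z y≢z x≈y x≁y x≁z y≁z
  ... | inj₂ (inj₁ x≈z) = nonTwinTriple⇒family x≢z x≢y (y≢z ∘ sym) x≈z x≁z x≁y (y≁z ∘ twins-sym G)
  ... | inj₂ (inj₂ y≈z) =
    nonTwinTriple⇒family y≢z (x≢y ∘ sym) (x≢z ∘ sym) y≈z y≁z (x≁y ∘ twins-sym G) (x≁z ∘ twins-sym G)

twinnedTriples⇒family : ∀ {n} (G : Graph n) → TwinnedTriples G → InFamilyOrComplement G
twinnedTriples⇒family {zero}  G _ = TwoClasses.inFamilyOrComplement G (λ ()) (λ {i} → ⊥-elim (¬Fin0 i))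
twinnedTriples⇒family {suc n} G twinned
  with any? (λ v → any? (λ w → ¬? (twins? G zero v) ×-dec ¬? (twins? G zero w) ×-dec ¬? (v ≟ w)
                               ×-dec ¬? (twins? G v w)))
... | yes (v , w , 0≁v , 0≁w , v≢w , v≁w) =
  pairwiseNonTwins⇒family G twinned (distinct 0≁v) (distinct 0≁w) v≢w 0≁v 0≁w v≁w
  where
  distinct : ∀ {v} → ¬ Twins G zero v → zero ≢ v
  distinct 0≁v 0≡v = 0≁v (subst (Twins G zero) 0≡v (twins-refl G))
... | no none = TwoClasses.inFamilyOrComplement G (λ v → does (twins? G zero v)) same-class⇒twins
  where
  same-class⇒twins : ∀ {i j} → does (twins? G zero i) ≡ does (twins? G zero j) → i ≢ j → Twins G i j
  same-class⇒twins {i} {j} = by-cases (twins? G zero i) (twins? G zero j)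
    where
    by-cases : (d : Dec (Twins G zero i)) (e : Dec (Twins G zero j)) → does d ≡ does e → i ≢ j → Twins G i j
    by-cases (yes 0≈i) (yes 0≈j) _ i≢j = twins-trans G 0≈i 0≈j i≢j
    by-cases (no 0≁i)  (no 0≁j)  _ i≢j =
      decidable-stable (twins? G i j) λ i≁j → none (i , j , 0≁i , 0≁j , i≢j , i≁j)
    by-cases (yes _)   (no _)    ()
    by-cases (no _)    (yes _)   ()

mainTheorem7 : (n : ℕ) → 3 ≤ n → (G : Graph n) →
    IsThDim G (n ∸ 1) ⇔ (InFamily G ⊎ InFamily (complement G))
mainTheorem7 n 3≤n G = mk⇔
  (twinnedTriples⇒family G ∘ thDimAtLeast⇒twinnedTriples G ∘ isThDim⇒thDimAtLeast G)
  (λ family →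
    let twinned , quadruples = inFamilyOrComplement⇒twins G family
    in thDimAtLeast⇒isThDim G 1≤n (twins⇒thDimAtLeast G 2≤n twinned quadruples))
  where
  2≤n : 2 ≤ n
  2≤n = ℕ.≤-trans (s≤s (s≤s z≤n)) 3≤n
  1≤n : 1 ≤ n
  1≤n = ℕ.≤-trans (s≤s z≤n) 2≤n
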